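{- Let $G$ be a connected graph. If $$|E(G)|>1+\max_{P\in\mathbf{P}}\sum_{v\in V(P)}\left(d_{\widehat{G}}(v)-1\right),$$ where $\mathbf{P}$ is the set of all shortest paths in $S(G)$ connecting vertices $w_{ij}$ (subdivision vertices), then $\widehat{G}\notin\mathfrak{N}$.
   Context: All graphs are finite, without loops or multiple edges. An interval $t$-coloring of a graph $H$ is a proper edge-coloring of $H$ with colors $1,\ldots,t$ such that every color is used and for every vertex $v$ the set of colors of edges incident to $v$ is an interval of integers. $\mathfrak{N}$ denotes the set of graphs having an interval $t$-coloring for some positive integer $t$. For a graph $G$ with vertices $v_1,\ldots,v_n$, $S(G)$ is the graph with vertex set $\{v_1,\ldots,v_n\}\cup\{w_{ij}:v_iv_j\in E(G)\}$ and edge set $\{v_iw_{ij},v_jw_{ij}:v_iv_j\in E(G)\}$ (every edge subdivided once). $\widehat{G}$ is obtained from $S(G)$ by adding a new vertex $u$ and the edges $uw_{ij}$ for all $v_iv_j\in E(G)$. $d_{\widehat{G}}(v)$ denotes the degree of $v$ in $\widehat{G}$; $V(P)$ is the vertex set of path $P$. -}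

module Defs where

open import Data.Nat using (ℕ; zero; suc; _+_; _∸_; _≤_; _<_)
open import Data.Fin using (Fin; zero; suc; _↑ˡ_; _↑ʳ_; splitAt; inject₁; fromℕ; _≟_)
open import Data.Bool using (Bool; true; false; _∨_)
open import Data.Product using (Σ; ∃; _×_; _,_; proj₁; proj₂)
open import Data.Sum using (_⊎_; inj₁; inj₂)
open import Relation.Nullary using (¬_)
open import Relation.Nullary.Decidable using (isYes)
open import Relation.Binary.PropositionalEquality using (_≡_; _≢_)
open import Function.Bundles using (_⇔_)
open import Function.Definitions using (Injective)

record Graph : Set where
  constructor mkGraph
  field
    n    : ℕ
    m    : ℕ
    ends : Fin m → Fin n × Fin n
open Graph public

V : Graph → Set
V G = Fin (n G)

E : Graph → Set
E G = Fin (m G)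

Inc : (G : Graph) → V G → E G → Set
Inc G x e = (x ≡ proj₁ (ends G e)) ⊎ (x ≡ proj₂ (ends G e))

IsSimple : Graph → Set
IsSimple G =
  (∀ e → proj₁ (ends G e) ≢ proj₂ (ends G e)) ×
  (∀ e e' → (∀ x → Inc G x e → Inc G x e') → e ≡ e')

Adj : (G : Graph) → V G → V G → Set
Adj G x y = Σ (E G) λ e → Inc G x e × Inc G y e × x ≢ y

record Walk (G : Graph) (k : ℕ) (x y : V G) : Set where
  field
    vtx   : Fin (suc k) → V G
    start : vtx zero ≡ x
    end   : vtx (fromℕ k) ≡ y
    step  : ∀ (i : Fin k) → Adj G (vtx (inject₁ i)) (vtx (suc i))
open Walk public

record Path (G : Graph) (k : ℕ) (x y : V G) : Set where
  field
    walk     : Walk G k x y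
    distinct : Injective _≡_ _≡_ (vtx walk)
open Path public

ShortestPath : (G : Graph) (k : ℕ) (x y : V G) → Set
ShortestPath G k x y = Path G k x y × (∀ k' → k' < k → ¬ Walk G k' x y)

Connected : Graph → Set
Connected G = ∀ (x y : V G) → Σ ℕ λ k → Walk G k x y

boolToℕ : Bool → ℕ
boolToℕ true  = 1
boolToℕ false = 0

count : ∀ {k} → (Fin k → Bool) → ℕ
count {zero}  f = 0
count {suc k} f = boolToℕ (f zero) + count (λ i → f (suc i))

sumFin : ∀ {k} → (Fin k → ℕ) → ℕ
sumFin {zero}  f = 0
sumFin {suc k} f = f zero + sumFin (λ i → f (suc i))

deg : (G : Graph) → V G → ℕ
deg G x = count λ e → isYes (x ≟ proj₁ (ends G e)) ∨ isYes (x ≟ proj₂ (ends G e))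

-- Subdivision S(G): vertices Fin (n + m); v_i = i ↑ˡ m, w_e = n ↑ʳ e.
-- Edges Fin (m + m): (e ↑ˡ m) = v_i w_e, (m ↑ʳ e) = v_j w_e, where ends e = (v_i, v_j).

vS : (G : Graph) → Fin (n G) → Fin (n G + m G)
vS G i = i ↑ˡ m G

wS : (G : Graph) → Fin (m G) → Fin (n G + m G)
wS G e = n G ↑ʳ e

S : Graph → Graph
S G = mkGraph (n G + m G) (m G + m G) ends'
  where
  ends' : Fin (m G + m G) → Fin (n G + m G) × Fin (n G + m G)
  ends' f with splitAt (m G) f
  ... | inj₁ e = vS G (proj₁ (ends G e)) , wS G e
  ... | inj₂ e = vS G (proj₂ (ends G e)) , wS G e

-- Ĝ: vertices Fin ((n + m) + 1); the vertices of S(G) embed via ↑ˡ 1,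
-- u = (n + m) ↑ʳ zero.  Edges Fin ((m + m) + m): the edges of S(G),
-- then u w_e for every edge e of G.

embS : (G : Graph) → Fin (n G + m G) → Fin ((n G + m G) + 1)
embS G x = x ↑ˡ 1

uHat : (G : Graph) → Fin ((n G + m G) + 1)
uHat G = (n G + m G) ↑ʳ zero

Hat : Graph → Graph
Hat G = mkGraph ((n G + m G) + 1) ((m G + m G) + m G) ends'
  where
  ends' : Fin ((m G + m G) + m G) → Fin ((n G + m G) + 1) × Fin ((n G + m G) + 1)
  ends' f with splitAt (m G + m G) f
  ... | inj₁ g = embS G (proj₁ (ends (S G) g)) , embS G (proj₂ (ends (S G) g))
  ... | inj₂ e = uHat G , embS G (wS G e)

-- interval t-coloring c of H (colors 1..t, all used, proper, interval at
-- every vertex; an empty colour set counts as an interval)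
record IntervalColoring (H : Graph) (t : ℕ) : Set where
  field
    col     : E H → ℕ
    inRange : ∀ e → 1 ≤ col e × col e ≤ t
    allUsed : ∀ k → 1 ≤ k → k ≤ t → Σ (E H) λ e → col e ≡ k
    proper  : ∀ e e' → e ≢ e' → (x : V H) → Inc H x e → Inc H x e' → col e ≢ col e'
    interval : ∀ (x : V H) → Σ ℕ λ a → Σ ℕ λ b → ∀ k →
                 ((a ≤ k × k ≤ b) ⇔ (Σ (E H) λ e → Inc H x e × col e ≡ k))

InN : Graph → Set
InN H = Σ ℕ λ t → 1 ≤ t × IntervalColoring H t

weightHat : (G : Graph) {k : ℕ} {x y : V (S G)} → Path (S G) k x y → ℕ
weightHat G P = sumFin λ i → deg (Hat G) (embS G (vtx (walk P) i)) ∸ 1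

module Submission where

-- Suppose Ĝ has an interval colouring.  The m = |E(G)| edges
-- u w_e at the apex u receive m distinct colours, so if w_α and w_β carry the
-- smallest and the largest of them, c(β) − c(α) ≥ m − 1.  On the other hand,
-- at any vertex x the colours of two edges at x differ by at most d(x) − 1
-- (the colours at x form an interval of at most d(x) integers); adding this up
-- along a shortest w_α–w_β path P of S(G) ⊆ Ĝ gives
-- c(β) − c(α) ≤ Σ_{v ∈ V(P)} (d_Ĝ(v) − 1), contradicting the hypothesis.

open import Defs
open import Data.Nat using (ℕ; zero; suc; _+_; _∸_; _≤_; _<_; z≤n; s≤s; _≤?_)
open import Data.Nat.Properties
open import Data.Nat.Induction using (<-rec)
open import Data.Fin as Fin using (Fin; zero; suc; toℕ; fromℕ<; fromℕ; inject₁; _↑ˡ_; _↑ʳ_; splitAt)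
open import Data.Fin.Properties using (toℕ-injective; toℕ-fromℕ<; toℕ-fromℕ; toℕ-inject₁; toℕ<n; splitAt-↑ˡ; splitAt-↑ʳ; injective⇒≤; ↑ˡ-injective; ↑ʳ-injective; toℕ-↑ˡ; toℕ-↑ʳ)
import Data.Fin.Properties as FinP
open import Data.Bool using (Bool; true; false; T; _∨_)
open import Data.Bool.Properties using (T-∨)
open import Data.List using (allFin)
open import Data.List.Extrema.Nat using (argmin; argmax; f[argmin]≤f[xs]; f[xs]≤f[argmax])
import Data.List.Relation.Unary.All as All
open import Data.List.Membership.Propositional.Properties using (∈-allFin)
open import Data.Product using (Σ; _×_; _,_; proj₁; proj₂)
open import Data.Sum as Sum using (inj₁; inj₂; [_,_]′; reduce)
open import Data.Empty using (⊥-elim)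
open import Function using (_∘_; id)
open import Function.Bundles using (Equivalence; _⇔_)
open import Function.Definitions using (Injective)
open import Relation.Nullary using (¬_; Dec; yes; no)
open import Relation.Nullary.Decidable using (isYes; fromWitness)
open import Relation.Binary.PropositionalEquality
open import Relation.Binary.Definitions using (tri<; tri≈; tri>)

private
  first : (b : Bool) → T b → (c : ℕ) → Fin (boolToℕ b + c)
  first true _ c = zero

  shift : (b : Bool) {c : ℕ} → Fin c → Fin (boolToℕ b + c)
  shift true  i = suc i
  shift false i = i

  first≢shift : (b : Bool) (p : T b) (c : ℕ) (i : Fin c) → first b p c ≢ shift b i
  first≢shift true p c i ()

  shift-injective : (b : Bool) {c : ℕ} {i j : Fin c} → shift b i ≡ shift b j → i ≡ j
  shift-injective true  eq = FinP.suc-injective eq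
  shift-injective false eq = eq

position : ∀ {s} (P : Fin s → Bool) (j : Fin s) → T (P j) → Fin (count P)
position {suc s} P zero    p = first (P zero) p (count (P ∘ suc))
position {suc s} P (suc j) p = shift (P zero) (position (P ∘ suc) j p)

position-injective : ∀ {s} (P : Fin s → Bool) {j j' : Fin s} (p : T (P j)) (p' : T (P j')) →
  position P j p ≡ position P j' p' → j ≡ j'
position-injective {suc s} P {zero}  {zero}   p p' eq = refl
position-injective {suc s} P {zero}  {suc j'} p p' eq = ⊥-elim (first≢shift (P zero) p _ _ eq)
position-injective {suc s} P {suc j} {zero}   p p' eq = ⊥-elim (first≢shift (P zero) p' _ _ (sym eq))
position-injective {suc s} P {suc j} {suc j'} p p' eq =
  cong suc (position-injective (P ∘ suc) p p' (shift-injective (P zero) eq))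

count-bound : ∀ {r s} (P : Fin s → Bool) (g : Fin r → Fin s) →
  Injective _≡_ _≡_ g → (∀ i → T (P (g i))) → r ≤ count P
count-bound P g g-injective marked =
  injective⇒≤ {f = λ i → position P (g i) (marked i)}
    (g-injective ∘ position-injective P (marked _) (marked _))

distinct-in-range : ∀ {r} (lo hi : ℕ) (f : Fin r → ℕ) → Injective _≡_ _≡_ f →
  (∀ i → lo ≤ f i) → (∀ i → f i ≤ hi) → r ≤ suc (hi ∸ lo)
distinct-in-range {r} lo hi f f-injective lo≤f f≤hi = injective⇒≤ {f = slot} slot-injective
  where
  slot : Fin r → Fin (suc (hi ∸ lo))
  slot i = fromℕ< (s≤s (∸-monoˡ-≤ lo (f≤hi i)))

  slot-injective : Injective _≡_ _≡_ slot
  slot-injective {i} {j} eq = f-injective (begin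
    f i            ≡⟨ sym (m∸n+n≡m (lo≤f i)) ⟩
    f i ∸ lo + lo  ≡⟨ cong (_+ lo) same-offset ⟩
    f j ∸ lo + lo  ≡⟨ m∸n+n≡m (lo≤f j) ⟩
    f j            ∎)
    where
    open ≡-Reasoning
    same-offset : f i ∸ lo ≡ f j ∸ lo
    same-offset = trans (sym (toℕ-fromℕ< _)) (trans (cong toℕ eq) (toℕ-fromℕ< _))

minimum-at : ∀ {r} (f : Fin r → ℕ) → Fin r → Σ (Fin r) λ a → ∀ b → f a ≤ f b
minimum-at f a₀ =
  argmin f a₀ (allFin _) , λ b → All.lookup (f[argmin]≤f[xs] a₀ (allFin _)) (∈-allFin b)

maximum-at : ∀ {r} (f : Fin r → ℕ) → Fin r → Σ (Fin r) λ a → ∀ b → f b ≤ f a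
maximum-at f a₀ =
  argmax f a₀ (allFin _) , λ b → All.lookup (f[xs]≤f[argmax] a₀ (allFin _)) (∈-allFin b)

incident? : (H : Graph) → V H → E H → Bool
incident? H x e = isYes (x Fin.≟ proj₁ (ends H e)) ∨ isYes (x Fin.≟ proj₂ (ends H e))

incident⇒marked : ∀ H x e → Inc H x e → T (incident? H x e)
incident⇒marked H x e at-x =
  Equivalence.from T-∨ (Sum.map (fromWitness {a? = x Fin.≟ x₁}) (fromWitness {a? = x Fin.≟ x₂}) at-x)
  where
  x₁ = proj₁ (ends H e)
  x₂ = proj₂ (ends H e)

module _ {H : Graph} {t : ℕ} (C : IntervalColoring H t) where
  open IntervalColoring C

  -- If e, e' are edges at x with col e ≤ col e', every colour between them
  -- lies in the interval at x and so is carried by its own edge at x.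
  colour-span : ∀ x {e e'} → Inc H x e → Inc H x e' → col e ≤ col e' →
    suc (col e' ∸ col e) ≤ deg H x
  colour-span x {e} {e'} at-e at-e' c≤c' =
    count-bound (incident? H x) edge edge-injective
      (λ i → incident⇒marked H x (edge i) (proj₁ (proj₂ (carrier i))))
    where
    open Equivalence
    lo hi : ℕ
    lo = proj₁ (interval x)
    hi = proj₁ (proj₂ (interval x))

    colours-at-x : ∀ k → (lo ≤ k × k ≤ hi) ⇔ (Σ (E H) λ f → Inc H x f × col f ≡ k)
    colours-at-x = proj₂ (proj₂ (interval x))

    in-interval : ∀ {f} → Inc H x f → lo ≤ col f × col f ≤ hi
    in-interval {f} at-f = from (colours-at-x (col f)) (f , at-f , refl)

    between : (i : Fin (suc (col e' ∸ col e))) → lo ≤ col e + toℕ i × col e + toℕ i ≤ hi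
    between i =
      ≤-trans (proj₁ (in-interval at-e)) (m≤m+n _ _) ,
      ≤-trans (+-monoʳ-≤ (col e) (≤-pred (toℕ<n i)))
              (≤-trans (≤-reflexive (m+[n∸m]≡n c≤c')) (proj₂ (in-interval at-e')))

    carrier : (i : Fin (suc (col e' ∸ col e))) → Σ (E H) λ f → Inc H x f × col f ≡ col e + toℕ i
    carrier i = to (colours-at-x (col e + toℕ i)) (between i)

    edge : Fin (suc (col e' ∸ col e)) → E H
    edge i = proj₁ (carrier i)

    edge-injective : Injective _≡_ _≡_ edge
    edge-injective {i} {j} eq = toℕ-injective (+-cancelˡ-≡ (col e) _ _
      (trans (sym (proj₂ (proj₂ (carrier i)))) (trans (cong col eq) (proj₂ (proj₂ (carrier j))))))

  colour-gap : ∀ x {e e'} → Inc H x e → Inc H x e' → col e' ≤ col e + (deg H x ∸ 1)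
  colour-gap x {e} {e'} at-e at-e' with col e' ≤? col e
  ... | yes c'≤c = ≤-trans c'≤c (m≤m+n _ _)
  ... | no  c'≰c = begin
    col e'                      ≡⟨ sym (m+[n∸m]≡n c≤c') ⟩
    col e + (col e' ∸ col e)    ≤⟨ +-monoʳ-≤ (col e) (∸-monoˡ-≤ 1 (colour-span x at-e at-e' c≤c')) ⟩
    col e + (deg H x ∸ 1)       ∎
    where
    open ≤-Reasoning
    c≤c' : col e ≤ col e'
    c≤c' = <⇒≤ (≰⇒> c'≰c)

  colour-drift : ∀ k (v : Fin (suc k) → V H) → (∀ i → Adj H (v (inject₁ i)) (v (suc i))) →
    ∀ {e e'} → Inc H (v zero) e → Inc H (v (fromℕ k)) e' →
    col e' ≤ col e + sumFin (λ i → deg H (v i) ∸ 1)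
  colour-drift zero v _ at-e at-e' =
    ≤-trans (colour-gap (v zero) at-e at-e') (+-monoʳ-≤ (col _) (m≤m+n (deg H (v zero) ∸ 1) 0))
  colour-drift (suc k) v adjacent {e} {e'} at-e at-e' with adjacent zero
  ... | g , at₀-g , at₁-g , _ = begin
    col e'                          ≤⟨ colour-drift k (v ∘ suc) (adjacent ∘ suc) at₁-g at-e' ⟩
    col g + rest                    ≤⟨ +-monoˡ-≤ rest (colour-gap (v zero) at-e at₀-g) ⟩
    col e + (deg H (v zero) ∸ 1) + rest  ≡⟨ +-assoc (col e) _ rest ⟩
    col e + sumFin (λ i → deg H (v i) ∸ 1)  ∎
    where
    open ≤-Reasoning
    rest : ℕ
    rest = sumFin (λ i → deg H (v (suc i)) ∸ 1)

-- A walk of length k indexed by ℕ: positions beyond k are irrelevant, which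
-- makes prepending a vertex and cutting out a closed segment simple.
record Walkℕ (H : Graph) (k : ℕ) (x y : V H) : Set where
  constructor walkℕ
  field
    pos       : ℕ → V H
    pos-start : pos 0 ≡ x
    pos-end   : pos k ≡ y
    pos-step  : ∀ i → i < k → Adj H (pos i) (pos (suc i))
open Walkℕ

adj-sym : ∀ {H x y} → Adj H x y → Adj H y x
adj-sym (e , at-x , at-y , x≢y) = e , at-y , at-x , x≢y ∘ sym

fromWalkℕ : ∀ {H k x y} → Walkℕ H k x y → Walk H k x y
fromWalkℕ {H} {k} w = record
  { vtx   = pos w ∘ toℕ
  ; start = pos-start w
  ; end   = trans (cong (pos w) (toℕ-fromℕ k)) (pos-end w)
  ; step  = λ i → subst₂ (Adj H) (cong (pos w) (sym (toℕ-inject₁ i))) refl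
                                 (pos-step w (toℕ i) (toℕ<n i))
  }

toWalkℕ : ∀ {H k x y} → Walk H k x y → Walkℕ H k x y
toWalkℕ {H} {k} W = walkℕ at (trans (at-toℕ zero refl) (start W))
  (trans (at-toℕ (fromℕ k) (toℕ-fromℕ k)) (end W)) at-step
  where
  -- positions beyond k are clamped to k
  at : ℕ → V H
  at n = vtx W (fromℕ< (s≤s (m⊓n≤n n k)))

  at-toℕ : ∀ {n} (j : Fin (suc k)) → toℕ j ≡ n → at n ≡ vtx W j
  at-toℕ j refl = cong (vtx W)
    (toℕ-injective (trans (toℕ-fromℕ< _) (m≤n⇒m⊓n≡m (≤-pred (toℕ<n j)))))

  at-step : ∀ i → i < k → Adj H (at i) (at (suc i))
  at-step i i<k = subst₂ (Adj H)
    (sym (at-toℕ (inject₁ j) (trans (toℕ-inject₁ j) (toℕ-fromℕ< i<k))))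
    (sym (at-toℕ (suc j) (cong suc (toℕ-fromℕ< i<k))))
    (step W j)
    where
    j : Fin k
    j = fromℕ< i<k

stay : ∀ {H} (x : V H) → Walkℕ H 0 x x
stay x = walkℕ (λ _ → x) refl refl (λ _ ())

prepend : ∀ {H k x y z} → Adj H x y → Walkℕ H k y z → Walkℕ H (suc k) x z
prepend {H} {k} {x} x~y w = walkℕ at refl (pos-end w) at-step
  where
  at : ℕ → V H
  at zero    = x
  at (suc n) = pos w n

  at-step : ∀ i → i < suc k → Adj H (at i) (at (suc i))
  at-step zero    _         = subst (Adj H x) (sym (pos-start w)) x~y
  at-step (suc i) (s≤s i<k) = pos-step w i i<k

drop-first : ∀ {H k x y} (w : Walkℕ H (suc k) x y) → Walkℕ H k (pos w 1) y
drop-first w = walkℕ (pos w ∘ suc) refl (pos-end w) (λ i i<k → pos-step w (suc i) (s≤s i<k))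

skip : {A : Set} → (ℕ → A) → ℕ → ℕ → ℕ → A
skip f i d n with n ≤? i
... | yes _ = f n
... | no  _ = f (n + d)

skip-≤ : ∀ {A : Set} (f : ℕ → A) {i d n} → n ≤ i → skip f i d n ≡ f n
skip-≤ f {i} {d} {n} n≤i with n ≤? i
... | yes _   = refl
... | no  n≰i = ⊥-elim (n≰i n≤i)

skip-≥ : ∀ {A : Set} (f : ℕ → A) {i d n} → f i ≡ f (i + d) → i ≤ n → skip f i d n ≡ f (n + d)
skip-≥ f {i} {d} {n} seam i≤n with n ≤? i
... | yes n≤i rewrite ≤-antisym n≤i i≤n = seam
... | no  _   = refl

shorten : ∀ {H k x y} (w : Walkℕ H k x y) {i j} → i < j → j ≤ k → pos w i ≡ pos w j →
  Σ ℕ λ k' → k' < k × Walkℕ H k' x y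
shorten {H} {k} {y = y} w {i} {j} i<j j≤k repeat =
  k ∸ d , ∸-monoʳ-< (m<n⇒0<n∸m i<j) d≤k ,
  walkℕ (skip (pos w) i d) (trans (skip-≤ (pos w) {i} {d} z≤n) (pos-start w)) at-end at-step
  where
  d : ℕ
  d = j ∸ i
  i+d≡j : i + d ≡ j
  i+d≡j = m+[n∸m]≡n (<⇒≤ i<j)
  seam : pos w i ≡ pos w (i + d)
  seam = trans repeat (cong (pos w) (sym i+d≡j))
  d≤k : d ≤ k
  d≤k = ≤-trans (m∸n≤m j i) j≤k
  i≤k∸d : i ≤ k ∸ d
  i≤k∸d = m+n≤o⇒m≤o∸n i (subst (_≤ k) (sym i+d≡j) j≤k)

  at-end : skip (pos w) i d (k ∸ d) ≡ y
  at-end = trans (skip-≥ (pos w) seam i≤k∸d) (trans (cong (pos w) (m∸n+n≡m d≤k)) (pos-end w))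

  at-step : ∀ n → n < k ∸ d → Adj H (skip (pos w) i d n) (skip (pos w) i d (suc n))
  at-step n n<k∸d = by-side (suc n ≤? i)
    where
    by-side : Dec (suc n ≤ i) → Adj H (skip (pos w) i d n) (skip (pos w) i d (suc n))
    by-side (yes n<i) = subst₂ (Adj H) (sym (skip-≤ (pos w) (<⇒≤ n<i))) (sym (skip-≤ (pos w) n<i))
      (pos-step w n (≤-trans n<k∸d (m∸n≤m k d)))
    by-side (no n≮i) = subst₂ (Adj H) (sym (skip-≥ (pos w) seam i≤n)) (sym (skip-≥ (pos w) seam (m≤n⇒m≤1+n i≤n)))
      (pos-step w (n + d) (subst (n + d <_) (m∸n+n≡m d≤k) (+-monoˡ-< d n<k∸d)))
      where
      i≤n : i ≤ n
      i≤n = ≤-pred (≰⇒> n≮i)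

-- By strong
-- induction on the length: a walk with no shorter rival is shortest, and it is
-- a path because a repeated vertex would let `shorten` produce a rival.
no-shortest-path⇒no-walk : ∀ {H x y} → (∀ k → ¬ ShortestPath H k x y) → ∀ k → ¬ Walkℕ H k x y
no-shortest-path⇒no-walk {H} {x} {y} none = <-rec (λ k → ¬ Walkℕ H k x y) no-walk
  where
  no-walk : ∀ k → (∀ {k'} → k' < k → ¬ Walkℕ H k' x y) → ¬ Walkℕ H k x y
  no-walk k shorter w = none k (path , λ k' k'<k W → shorter k'<k (toWalkℕ W))
    where
    no-repeat : ∀ {i j} → i < j → j ≤ k → pos w i ≢ pos w j
    no-repeat i<j j≤k repeat with shorten w i<j j≤k repeat
    ... | _ , k'<k , w' = shorter k'<k w'

    distinct-positions : Injective _≡_ _≡_ (pos w ∘ toℕ)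
    distinct-positions {i} {j} eq with <-cmp (toℕ i) (toℕ j)
    ... | tri< i<j _ _ = ⊥-elim (no-repeat i<j (≤-pred (toℕ<n j)) eq)
    ... | tri≈ _ i≡j _ = toℕ-injective i≡j
    ... | tri> _ _ j<i = ⊥-elim (no-repeat j<i (≤-pred (toℕ<n i)) (sym eq))

    path : Path H k x y
    path = record { walk = fromWalkℕ w ; distinct = distinct-positions }

module _ (G : Graph) where

  uw-edge : E G → E (Hat G)
  uw-edge e = (m G + m G) ↑ʳ e

  origin : E (Hat G) → E G
  origin f = [ reduce ∘ splitAt (m G) , id ]′ (splitAt (m G + m G) f)

  ends-S-first : ∀ e → ends (S G) (e ↑ˡ m G) ≡ (vS G (proj₁ (ends G e)) , wS G e)
  ends-S-first e rewrite splitAt-↑ˡ (m G) e (m G) = refl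

  ends-S-second : ∀ e → ends (S G) (m G ↑ʳ e) ≡ (vS G (proj₂ (ends G e)) , wS G e)
  ends-S-second e rewrite splitAt-↑ʳ (m G) (m G) e = refl

  ends-Hat-S : ∀ g → ends (Hat G) (g ↑ˡ m G) ≡ (embS G (proj₁ (ends (S G) g)) , embS G (proj₂ (ends (S G) g)))
  ends-Hat-S g rewrite splitAt-↑ˡ (m G + m G) g (m G) = refl

  ends-Hat-uw : ∀ e → ends (Hat G) (uw-edge e) ≡ (uHat G , embS G (wS G e))
  ends-Hat-uw e rewrite splitAt-↑ʳ (m G + m G) (m G) e = refl

  u-incident : ∀ e → Inc (Hat G) (uHat G) (uw-edge e)
  u-incident e = inj₁ (sym (cong proj₁ (ends-Hat-uw e)))

  w-incident : ∀ e → Inc (Hat G) (embS G (wS G e)) (uw-edge e)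
  w-incident e = inj₂ (sym (cong proj₂ (ends-Hat-uw e)))

  v≢w : ∀ x e → vS G x ≢ wS G e
  v≢w x e eq = <⇒≱ (toℕ<n x) (begin
    n G                ≤⟨ m≤m+n (n G) (toℕ e) ⟩
    n G + toℕ e        ≡⟨ sym (toℕ-↑ʳ (n G) e) ⟩
    toℕ (wS G e)       ≡⟨ cong toℕ (sym eq) ⟩
    toℕ (vS G x)       ≡⟨ toℕ-↑ˡ x (m G) ⟩
    toℕ x              ∎)
    where open ≤-Reasoning

  v-w-adjacent : ∀ {x e} → Inc G x e → Adj (S G) (vS G x) (wS G e)
  v-w-adjacent {x} {e} (inj₁ p) =
    e ↑ˡ m G , inj₁ (trans (cong (vS G) p) (sym (cong proj₁ (ends-S-first e)))) ,
    inj₂ (sym (cong proj₂ (ends-S-first e))) , v≢w x e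
  v-w-adjacent {x} {e} (inj₂ p) =
    m G ↑ʳ e , inj₁ (trans (cong (vS G) p) (sym (cong proj₁ (ends-S-second e)))) ,
    inj₂ (sym (cong proj₂ (ends-S-second e))) , v≢w x e

  subdivide-walk : ∀ k {x y e} → Walkℕ G k x y → Inc G y e → Σ ℕ λ l → Walkℕ (S G) l (vS G x) (wS G e)
  subdivide-walk zero {e = e} w at-y =
    1 , prepend (v-w-adjacent (subst (λ z → Inc G z e) (trans (sym (pos-end w)) (pos-start w)) at-y)) (stay _)
  subdivide-walk (suc k) w at-y with pos-step w 0 (s≤s z≤n) | subdivide-walk k (drop-first w) at-y
  ... | f , at₀ , at₁ , _ | l , w' =
    suc (suc l) ,
    prepend (v-w-adjacent (subst (λ z → Inc G z f) (pos-start w) at₀))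
            (prepend (adj-sym (v-w-adjacent at₁)) w')

  subdivision-connects : Connected G → ∀ a b → Σ ℕ λ l → Walkℕ (S G) l (wS G a) (wS G b)
  subdivision-connects connected a b with connected (proj₁ (ends G a)) (proj₁ (ends G b))
  ... | k , W with subdivide-walk k (toWalkℕ W) (inj₁ refl)
  ...   | l , w = suc l , prepend (adj-sym (v-w-adjacent (inj₁ refl))) w

  embS-adjacent : ∀ {x y} → Adj (S G) x y → Adj (Hat G) (embS G x) (embS G y)
  embS-adjacent {x} {y} (g , at-x , at-y , x≢y) =
    g ↑ˡ m G , lift at-x , lift at-y , x≢y ∘ ↑ˡ-injective 1 x y
    where
    lift : ∀ {z} → Inc (S G) z g → Inc (Hat G) (embS G z) (g ↑ˡ m G)
    lift (inj₁ p) rewrite ends-Hat-S g = inj₁ (cong (embS G) p)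
    lift (inj₂ p) rewrite ends-Hat-S g = inj₂ (cong (embS G) p)

theorem10 : (G : Graph) → IsSimple G → Connected G →
    (∀ (a b : E G) (k : ℕ) (P : ShortestPath (S G) k (wS G a) (wS G b)) →
       suc (weightHat G (proj₁ P)) < m G) →
    ¬ InN (Hat G)
theorem10 G _ connected light (t , 1≤t , C) =
  no-shortest-path⇒no-walk no-shortest-path _ (proj₂ (subdivision-connects G connected α β))
  where
  open IntervalColoring C

  c : E G → ℕ
  c a = col (uw-edge G a)

  -- G has an edge, since colour 1 is used on some edge of Ĝ
  some-edge : E G
  some-edge = origin G (proj₁ (allUsed 1 ≤-refl 1≤t))

  α β : E G
  α = proj₁ (minimum-at c some-edge)
  β = proj₁ (maximum-at c some-edge)

  c-injective : Injective _≡_ _≡_ c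
  c-injective {a} {b} eq with a Fin.≟ b
  ... | yes a≡b = a≡b
  ... | no  a≢b = ⊥-elim (proper (uw-edge G a) (uw-edge G b) (a≢b ∘ ↑ʳ-injective _ a b)
                                 (uHat G) (u-incident G a) (u-incident G b) eq)

  spread : m G ≤ suc (c β ∸ c α)
  spread = distinct-in-range (c α) (c β) c c-injective
             (proj₂ (minimum-at c some-edge)) (proj₂ (maximum-at c some-edge))

  no-shortest-path : ∀ k → ¬ ShortestPath (S G) k (wS G α) (wS G β)
  no-shortest-path k P = <⇒≱ (light α β k P) (≤-trans spread (s≤s (m≤n+o⇒m∸n≤o (c β) (c α) drift)))
    where
    W : Walk (S G) k (wS G α) (wS G β)
    W = walk (proj₁ P)

    drift : c β ≤ c α + weightHat G (proj₁ P)
    drift = colour-drift C k (embS G ∘ vtx W) (embS-adjacent G ∘ step W)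
      (subst (λ z → Inc (Hat G) (embS G z) (uw-edge G α)) (sym (start W)) (w-incident G α))
      (subst (λ z → Inc (Hat G) (embS G z) (uw-edge G β)) (sym (end W)) (w-incident G β))
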